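{- For each integer $r>0$, in $\mathbb{Q}[[q]][[x_1,\ldots,x_r]]$, \[ g(x_1,\ldots,x_r)=H\binom{1,\ldots,1,1}{x_r-x_{r-1},\ldots,x_2-x_1,x_1}. \]
   Context: For integers $n_i\ge1$, $g_{n_1,\ldots,n_r}(q)=\frac{(-2\pi\sqrt{ -1})^{n_1+\cdots+n_r}}{(n_1-1)!\cdots(n_r-1)!}\sum_{0<u_1<\cdots<u_r}\sum_{v_1,\ldots,v_r>0}v_1^{n_1-1}\cdots v_r^{n_r-1}q^{u_1v_1+\cdots+u_rv_r}$, and $g(x_1,\ldots,x_r)=\sum_{n_1,\ldots,n_r\ge1}\frac{g_{n_1,\ldots,n_r}(q)}{(-2\pi\sqrt{ -1})^{n_1+\cdots+n_r}}x_1^{n_1-1}\cdots x_r^{n_r-1}$. For positive integers $n_i$ and commuting variables (or linear combinations of variables) $z_i$, $H\binom{n_1,\ldots,n_r}{z_1,\ldots,z_r}=\sum_{0<u_1<\cdots<u_r}e^{u_1z_1}\big(\frac{q^{u_1}}{1-q^{u_1}}\big)^{n_1}\cdots e^{u_rz_r}\big(\frac{q^{u_r}}{1-q^{u_r}}\big)^{n_r}$, a power series with coefficients in $\mathbb{Q}[[q]]$. -}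

module Defs where

open import Data.Bool using (Bool; true; false; _∧_; if_then_else_)
open import Data.Nat as ℕ using (ℕ; zero; suc; _≡ᵇ_; _<ᵇ_; _!)
open import Data.Nat.Properties using (_!≢0)
open import Data.Nat.Combinatorics using (_C_)
open import Data.Integer as ℤ using (ℤ; +_)
open import Data.Rational as ℚ using (ℚ; 0ℚ; 1ℚ)
open import Data.Fin using (Fin; toℕ)
open import Data.List as List using (List; []; _∷_; concatMap; upTo)
open import Data.Vec as Vec using (Vec; []; _∷_; lookup; allFin)

Σℚ : List ℚ → ℚ
Σℚ = List.foldr ℚ._+_ 0ℚ

Πℚ : ∀ {d} → Vec ℚ d → ℚ
Πℚ = Vec.foldr _ ℚ._*_ 1ℚ

boxVecs : (d N : ℕ) → List (Vec ℕ d)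
boxVecs zero    N = [] ∷ []
boxVecs (suc d) N =
  concatMap (λ a → List.map (a ∷_) (boxVecs d N)) (List.map suc (upTo N))

-- 0 < u₁ < u₂ < ⋯ < u_d  (positivity is guaranteed by boxVecs)
strictlyIncreasing : ∀ {d} → Vec ℕ d → Bool
strictlyIncreasing []           = true
strictlyIncreasing (a ∷ [])     = true
strictlyIncreasing (a ∷ b ∷ us) = (a <ᵇ b) ∧ strictlyIncreasing (b ∷ us)

dot : ∀ {d} → Vec ℕ d → Vec ℕ d → ℕ
dot us vs = Vec.foldr _ ℕ._+_ 0 (Vec.zipWith ℕ._*_ us vs)

powDivFact : ℤ → ℕ → ℚ
powDivFact c m = (c ℤ.^ m) ℚ./ (m !)
  where instance _ = m !≢0

-- Sum over all (u, v) with 0 < u₁ < ⋯ < u_d, v₁,…,v_d > 0 and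
-- u₁v₁ + ⋯ + u_dv_d = N of F u v  (entries ≤ N suffice).
ΣuvAt : (d N : ℕ) → (Vec ℕ d → Vec ℕ d → ℚ) → ℚ
ΣuvAt d N F =
  Σℚ (concatMap (λ u → List.map (λ v →
        if strictlyIncreasing u ∧ (dot u v ≡ᵇ N) then F u v else 0ℚ)
        (boxVecs d N)) (boxVecs d N))

-- Elements of ℚ[[q]][[x₁,…,x_r]] are represented by their coefficient
-- functions: F N m = coefficient of q^N x₁^{m₁} ⋯ x_r^{m_r}.

Series : ℕ → Set
Series r = ℕ → Vec ℕ r → ℚ

-- g(x₁,…,x_r) = Σ_{n} g_{n}(q)/(-2πi)^{|n|} x^{n-1}.  With m_i = n_i - 1,
-- the coefficient of q^N x^m is
--   Σ_{0<u₁<⋯<u_r} Σ_{v>0, Σ u_i v_i = N} Π_i v_i^{m_i} / m_i!.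
g : (r : ℕ) → Series r
g r N m = ΣuvAt r N (λ u v →
  Πℚ (Vec.zipWith (λ vᵢ mᵢ → powDivFact (+ vᵢ) mᵢ) v m))

-- H(n₁,…,n_d ; z₁,…,z_d) with z_i = Σ_j z_i[j] x_j linear forms in
-- x₁,…,x_k with integer coefficients and n_i ≥ 1:
--   Σ_{0<u₁<⋯<u_d} Π_i e^{u_i z_i} (q^{u_i}/(1-q^{u_i}))^{n_i}.
-- Using (q^u/(1-q^u))^n = Σ_{w ≥ 1} ((w-1) C (n-1)) q^{u w} and
-- e^{Σ_j c_j x_j} = Σ_m Π_j c_j^{m_j}/m_j! x^m  with c_j = Σ_i u_i z_i[j],
-- the coefficient of q^N x^m is given below.
H : (d k : ℕ) → Vec ℕ d → Vec (Vec ℤ k) d → Series k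
H d k ns zs N m = ΣuvAt d N (λ u w →
    Πℚ (Vec.zipWith (λ wᵢ nᵢ → ((+ ((wᵢ ℕ.∸ 1) C (nᵢ ℕ.∸ 1))) ℚ./ 1)) w ns)
  ℚ.* Πℚ (Vec.zipWith powDivFact (lin u) m))
  where
  lin : Vec ℕ d → Vec ℤ k
  lin u = Vec.map (λ j → Vec.foldr _ ℤ._+_ (+ 0)
            (Vec.zipWith (λ uᵢ zᵢ → (+ uᵢ) ℤ.* lookup zᵢ j) u zs)) (allFin k)

-- The linear forms (x_r - x_{r-1}, …, x₂ - x₁, x₁) in x₁,…,x_r.
-- 0-based: the i-th form is e_{r-1-i} - e_{r-2-i}  (with e_{-1} = 0), i.e.
-- its coefficient at x_j is +1 if i+j+1 = r, -1 if i+j+2 = r, else 0.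
diffForms : (r : ℕ) → Vec (Vec ℤ r) r
diffForms r = Vec.map (λ i → Vec.map (λ j →
    if suc (toℕ i ℕ.+ toℕ j) ≡ᵇ r then + 1
    else if suc (suc (toℕ i ℕ.+ toℕ j)) ≡ᵇ r then ℤ.- (+ 1)
    else + 0) (allFin r)) (allFin r)

{-# OPTIONS --safe #-}
-- In both series the coefficient of q^N x^m is a sum over the pairs (u, v) of vectors in
-- {1,…,N}^r with u₁ < ⋯ < u_r and u·v = N.  On the g side the summand is Π vᵢ^mᵢ/mᵢ!; on the
-- H side, since all nᵢ = 1, it is Π cⱼ^mⱼ/mⱼ! where cⱼ = u_{r+1-j} − u_{r-j} (u₀ = 0) is the
-- coefficient of xⱼ in Σ uᵢ zᵢ.  The map (u, v) ↦ (partial sums of v reversed, differences of u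
-- reversed) is an involution of the index set (it preserves u·v by Abel summation) under which
-- c becomes v, so it carries one summand onto the other.
module Submission where

open import Defs
open import Data.Nat using (ℕ; _<_)
open import Data.Vec using (Vec; replicate)
open import Relation.Binary.PropositionalEquality using (_≡_)

open import Algebra.Bundles using (CommutativeMonoid)
open import Data.Bool using (Bool; true; false; T; if_then_else_; _∧_)
open import Data.Bool.Properties using (T?; T-∧)
open import Data.Empty using (⊥-elim)
open import Data.Fin using (Fin; zero; suc; toℕ)
open import Data.Fin.Properties using (toℕ<n)
open import Data.Integer as ℤ using (ℤ)
import Data.Integer.Properties as ℤ
import Data.Integer.Tactic.RingSolver as ℤ
open import Data.List as List using (List; []; _∷_; _++_; concatMap; cartesianProduct; cartesianProductWith; upTo)
open import Data.List.Membership.Propositional using (_∈_)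
open import Data.List.Membership.Propositional.Properties
  using (∈-map⁺; ∈-map⁻; ∈-upTo⁺; ∈-upTo⁻; ∈-cartesianProductWith⁺; ∈-cartesianProductWith⁻; ∈-cartesianProduct⁺; ∈-cartesianProduct⁻)
open import Data.List.Properties using (map-++; map-∘)
open import Data.List.Relation.Unary.All as All using (All; []; _∷_)
open import Data.List.Relation.Unary.Any using (here; there)
open import Data.List.Relation.Unary.Unique.Propositional using (Unique; []; _∷_)
import Data.List.Relation.Unary.Unique.Propositional.Properties as Unique
open import Data.Nat using (zero; suc; _+_; _*_; _∸_; _≤_; z≤n; s≤s; _<ᵇ_; _≡ᵇ_; _≟_)
open import Data.Nat.Properties
open import Data.Nat.Tactic.RingSolver using (solve-∀)
open import Data.Nat.Combinatorics using (_C_)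
open import Data.Product using (_×_; _,_; proj₁; proj₂; uncurry)
open import Data.Product.Properties using () renaming (≡-dec to ×-≡-dec)
open import Data.Rational as ℚ using (ℚ; 0ℚ; 1ℚ)
import Data.Rational.Properties as ℚ
open import Data.Vec as Vec using ([]; _∷_; _∷ʳ_; reverse; sum; lookup; allFin; tabulate)
open import Data.Vec.Properties
  using (∷-injective; reverse-∷; reverse-involutive; map-cong; map-lookup-allFin; tabulate-allFin;
         lookup-map; lookup-allFin; zipWith-map₁)
  renaming (≡-dec to Vec-≡-dec)
open import Data.Vec.Relation.Unary.All as VAll using ([]; _∷_) renaming (All to VAll)
open import Data.Vec.Relation.Unary.Linked as Linked using (Linked; []; [-]; _∷_)
open import Data.Vec.Relation.Unary.Linked.Properties using (Linked⇒All)
open import Function using (_∘_)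
open import Function.Bundles using (_⇔_; mk⇔; Equivalence)
open import Level using (Level)
open import Relation.Binary.Definitions using (DecidableEquality)
open import Relation.Binary.PropositionalEquality using (refl; sym; trans; cong; cong₂; subst; subst₂; _≢_; module ≡-Reasoning)
open import Relation.Nullary using (Dec; yes; no; does)
open import Relation.Nullary.Decidable using (_×-dec_)
open import Algebra.Properties.CommutativeSemigroup
  (CommutativeMonoid.commutativeSemigroup ℚ.+-0-commutativeMonoid) using (interchange)

private
  variable
    a b : Level
    A : Set a
    B : Set b
    n : ℕ

∑ : List A → (A → ℚ) → ℚ
∑ xs f = Σℚ (List.map f xs)

∑-cong : ∀ {xs : List A} {f g : A → ℚ} → (∀ {x} → x ∈ xs → f x ≡ g x) → ∑ xs f ≡ ∑ xs g
∑-cong {xs = []}     f≗g = refl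
∑-cong {xs = x ∷ xs} f≗g = cong₂ ℚ._+_ (f≗g (here refl)) (∑-cong (f≗g ∘ there))

∑-zero : ∀ (xs : List A) → ∑ xs (λ _ → 0ℚ) ≡ 0ℚ
∑-zero []       = refl
∑-zero (x ∷ xs) = trans (ℚ.+-identityˡ _) (∑-zero xs)

∑-distrib-+ : ∀ (xs : List A) f g → ∑ xs (λ x → f x ℚ.+ g x) ≡ ∑ xs f ℚ.+ ∑ xs g
∑-distrib-+ []       f g = sym (ℚ.+-identityˡ 0ℚ)
∑-distrib-+ (x ∷ xs) f g =
  trans (cong (f x ℚ.+ g x ℚ.+_) (∑-distrib-+ xs f g)) (interchange (f x) (g x) _ _)

∑-swap : ∀ (xs : List A) (ys : List B) (f : A → B → ℚ) →
         ∑ xs (λ x → ∑ ys (f x)) ≡ ∑ ys (λ y → ∑ xs (λ x → f x y))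
∑-swap []       ys f = sym (∑-zero ys)
∑-swap (x ∷ xs) ys f =
  trans (cong (∑ ys (f x) ℚ.+_) (∑-swap xs ys f)) (sym (∑-distrib-+ ys (f x) _))

module _ (_≟_ : DecidableEquality A) where

  δ : A → A → ℚ → ℚ
  δ y x c = if does (y ≟ x) then c else 0ℚ

  ∑-δ-∉ : ∀ {x} {xs : List A} c → All (_≢ x) xs → ∑ xs (λ y → δ y x c) ≡ 0ℚ
  ∑-δ-∉ c [] = refl
  ∑-δ-∉ {x} {y ∷ _} c (y≢x ∷ xs≢x) with y ≟ x
  ... | yes y≡x = ⊥-elim (y≢x y≡x)
  ... | no  _   = trans (ℚ.+-identityˡ _) (∑-δ-∉ c xs≢x)

  ∑-δ : ∀ {x} {xs : List A} c → Unique xs → x ∈ xs → ∑ xs (λ y → δ y x c) ≡ c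
  ∑-δ {x} c (y≢xs ∷ xs!) (here refl) with x ≟ x
  ... | yes _  = trans (cong (c ℚ.+_) (∑-δ-∉ c (All.map (_∘ sym) y≢xs))) (ℚ.+-identityʳ c)
  ... | no x≢x = ⊥-elim (x≢x refl)
  ∑-δ {x} {xs = y ∷ _} c (y≢xs ∷ xs!) (there x∈xs) with y ≟ x
  ... | yes refl = ⊥-elim (All.lookup y≢xs x∈xs refl)
  ... | no  _    = trans (ℚ.+-identityˡ _) (∑-δ c xs! x∈xs)

restrict : (A → Bool) → (A → ℚ) → A → ℚ
restrict P h x = if P x then h x else 0ℚ

module Reindex (_≟_ : DecidableEquality A) {xs : List A} (xs! : Unique xs)
  (P : A → Bool) (σ : A → A)
  (σ-involution : ∀ {x} → x ∈ xs → T (P x) → σ x ∈ xs × T (P (σ x)) × σ (σ x) ≡ x)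
  where

  private
    InGraph : A → A → Set _
    InGraph x y = T (P x) × y ≡ σ x

    inGraph? : ∀ x y → Dec (InGraph x y)
    inGraph? x y = T? (P x) ×-dec (y ≟ σ x)

    inGraph-sym : ∀ {x y} → x ∈ xs → InGraph x y → InGraph y x
    inGraph-sym x∈xs (Px , refl) with _ , Pσx , σσx≡x ← σ-involution x∈xs Px = Pσx , sym σσx≡x

    term : (A → ℚ) → A → A → ℚ
    term h x y = if does (inGraph? x y) then h x else 0ℚ

    ∑-term : ∀ h {x} → x ∈ xs → ∑ xs (term h x) ≡ restrict P h x
    ∑-term h {x} x∈xs with P x in Px
    ... | true  = ∑-δ _≟_ (h x) xs! (proj₁ (σ-involution x∈xs (subst T (sym Px) _)))
    ... | false = ∑-zero xs

    term-swap : ∀ f g → (∀ {x} → x ∈ xs → T (P x) → g (σ x) ≡ f x) →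
                ∀ {x y} → x ∈ xs → y ∈ xs → term f x y ≡ term g y x
    term-swap f g g∘σ≡f {x} {y} x∈xs y∈xs = cases (inGraph? x y) (inGraph? y x)
      where
      cases : (dxy : Dec (InGraph x y)) (dyx : Dec (InGraph y x)) →
              (if does dxy then f x else 0ℚ) ≡ (if does dyx then g y else 0ℚ)
      cases (yes (Px , refl)) (yes _)  = sym (g∘σ≡f x∈xs Px)
      cases (yes xy)          (no ¬yx) = ⊥-elim (¬yx (inGraph-sym x∈xs xy))
      cases (no ¬xy)          (yes yx) = ⊥-elim (¬xy (inGraph-sym y∈xs yx))
      cases (no _)            (no _)   = refl

  -- Both sides are the sum of `term` over the graph of σ on P, read from either end.
  ∑-restrict-involution : ∀ (f g : A → ℚ) → (∀ {x} → x ∈ xs → T (P x) → g (σ x) ≡ f x) →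
                          ∑ xs (restrict P f) ≡ ∑ xs (restrict P g)
  ∑-restrict-involution f g g∘σ≡f = begin
    ∑ xs (restrict P f)                     ≡⟨ ∑-cong (sym ∘ ∑-term f) ⟩
    ∑ xs (λ x → ∑ xs (term f x))            ≡⟨ ∑-swap xs xs (term f) ⟩
    ∑ xs (λ y → ∑ xs (λ x → term f x y))    ≡⟨ ∑-cong (λ y∈xs → ∑-cong (λ x∈xs → term-swap f g g∘σ≡f x∈xs y∈xs)) ⟩
    ∑ xs (λ y → ∑ xs (term g y))            ≡⟨ ∑-cong (∑-term g) ⟩
    ∑ xs (restrict P g)                     ∎
    where open ≡-Reasoning

cartesianProductWith≡concatMap : ∀ {c} {C : Set c} (f : A → B → C) xs ys →
  cartesianProductWith f xs ys ≡ concatMap (λ x → List.map (f x) ys) xs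
cartesianProductWith≡concatMap f []       ys = refl
cartesianProductWith≡concatMap f (x ∷ xs) ys =
  cong (List.map (f x) ys ++_) (cartesianProductWith≡concatMap f xs ys)

map-cartesianProductWith : ∀ {c d} {C : Set c} {D : Set d} (g : C → D) (f : A → B → C) xs ys →
  List.map g (cartesianProductWith f xs ys) ≡ cartesianProductWith (λ x y → g (f x y)) xs ys
map-cartesianProductWith g f []       ys = refl
map-cartesianProductWith g f (x ∷ xs) ys = begin
  List.map g (List.map (f x) ys ++ cartesianProductWith f xs ys)
    ≡⟨ map-++ g (List.map (f x) ys) _ ⟩
  List.map g (List.map (f x) ys) ++ List.map g (cartesianProductWith f xs ys)
    ≡⟨ cong₂ _++_ (sym (map-∘ ys)) (map-cartesianProductWith g f xs ys) ⟩
  List.map (λ y → g (f x y)) ys ++ cartesianProductWith (λ x y → g (f x y)) xs ys ∎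
  where open ≡-Reasoning

InBox : ℕ → Vec ℕ n → Set
InBox N = VAll (λ a → 0 < a × a ≤ N)

private
  ∈-range⁺ : ∀ {N a} → 0 < a → a ≤ N → a ∈ List.map suc (upTo N)
  ∈-range⁺ (s≤s z≤n) a≤N = ∈-map⁺ suc (∈-upTo⁺ a≤N)

  ∈-range⁻ : ∀ {N a} → a ∈ List.map suc (upTo N) → 0 < a × a ≤ N
  ∈-range⁻ a∈ with _ , i∈ , refl ← ∈-map⁻ suc a∈ = s≤s z≤n , ∈-upTo⁻ i∈

boxVecs-suc : ∀ d N → boxVecs (suc d) N ≡ cartesianProductWith _∷_ (List.map suc (upTo N)) (boxVecs d N)
boxVecs-suc d N = sym (cartesianProductWith≡concatMap _∷_ (List.map suc (upTo N)) (boxVecs d N))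

∈-boxVecs⁺ : ∀ {d N} {x : Vec ℕ d} → InBox N x → x ∈ boxVecs d N
∈-boxVecs⁺ [] = here refl
∈-boxVecs⁺ {suc d} {N} ((0<a , a≤N) ∷ x∈) rewrite boxVecs-suc d N =
  ∈-cartesianProductWith⁺ _∷_ (∈-range⁺ 0<a a≤N) (∈-boxVecs⁺ x∈)

∈-boxVecs⁻ : ∀ {d N} {x : Vec ℕ d} → x ∈ boxVecs d N → InBox N x
∈-boxVecs⁻ {zero}  {x = []} _ = []
∈-boxVecs⁻ {suc d} {N} x∈ rewrite boxVecs-suc d N
  with _ , _ , a∈ , y∈ , refl ← ∈-cartesianProductWith⁻ _∷_ (List.map suc (upTo N)) (boxVecs d N) x∈ =
  ∈-range⁻ a∈ ∷ ∈-boxVecs⁻ y∈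

boxVecs-unique : ∀ d N → Unique (boxVecs d N)
boxVecs-unique zero    N = [] ∷ []
boxVecs-unique (suc d) N rewrite boxVecs-suc d N =
  Unique.cartesianProductWith⁺ _∷_ ∷-injective
    (Unique.map⁺ suc-injective (Unique.upTo⁺ N)) (boxVecs-unique d N)

partialSumsFrom : ℕ → Vec ℕ n → Vec ℕ n
partialSumsFrom c []       = []
partialSumsFrom c (a ∷ as) = c + a ∷ partialSumsFrom (c + a) as

partialSums : Vec ℕ n → Vec ℕ n
partialSums = partialSumsFrom 0

differencesFrom : ℕ → Vec ℕ n → Vec ℕ n
differencesFrom c []       = []
differencesFrom c (x ∷ xs) = x ∸ c ∷ differencesFrom x xs

differences : Vec ℕ n → Vec ℕ n
differences = differencesFrom 0

tailSums : Vec ℕ n → Vec ℕ n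
tailSums []       = []
tailSums (a ∷ as) = a + sum as ∷ tailSums as

differencesFrom-partialSumsFrom : ∀ c (a : Vec ℕ n) → differencesFrom c (partialSumsFrom c a) ≡ a
differencesFrom-partialSumsFrom c []       = refl
differencesFrom-partialSumsFrom c (a ∷ as) =
  cong₂ _∷_ (m+n∸m≡n c a) (differencesFrom-partialSumsFrom (c + a) as)

partialSumsFrom-differencesFrom : ∀ {c} {x : Vec ℕ n} → Linked _≤_ (c ∷ x) →
                                  partialSumsFrom c (differencesFrom c x) ≡ x
partialSumsFrom-differencesFrom {x = []}     _            = refl
partialSumsFrom-differencesFrom {x = x ∷ xs} (c≤x ∷ x≤xs) =
  cong₂ _∷_ (m+[n∸m]≡n c≤x) (trans (cong (λ y → partialSumsFrom y (differencesFrom x xs)) (m+[n∸m]≡n c≤x))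
                                 (partialSumsFrom-differencesFrom x≤xs))

partialSumsFrom-increasing : ∀ c {a : Vec ℕ n} → VAll (0 <_) a → Linked _<_ (c ∷ partialSumsFrom c a)
partialSumsFrom-increasing c []                          = [-]
partialSumsFrom-increasing c {a ∷ _} (0<a ∷ as) =
  subst (_≤ c + a) (+-comm c 1) (+-monoʳ-≤ c 0<a) ∷ partialSumsFrom-increasing (c + a) as

partialSumsFrom-≤ : ∀ {c N} (a : Vec ℕ n) → c + sum a ≤ N → VAll (_≤ N) (partialSumsFrom c a)
partialSumsFrom-≤         []       _ = []
partialSumsFrom-≤ {c = c} {N} (a ∷ as) ≤N =
  ≤-trans (m≤m+n (c + a) (sum as)) c+a+as≤N ∷ partialSumsFrom-≤ as c+a+as≤N
  where
  c+a+as≤N : c + a + sum as ≤ N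
  c+a+as≤N = subst (_≤ N) (sym (+-assoc c a (sum as))) ≤N

differencesFrom-positive : ∀ {c} {x : Vec ℕ n} → Linked _<_ (c ∷ x) → VAll (0 <_) (differencesFrom c x)
differencesFrom-positive {x = []}     _            = []
differencesFrom-positive {x = _ ∷ _}  (c<x ∷ x<xs) = m<n⇒0<n∸m c<x ∷ differencesFrom-positive x<xs

differencesFrom-≤ : ∀ {c N} {x : Vec ℕ n} → VAll (_≤ N) x → VAll (_≤ N) (differencesFrom c x)
differencesFrom-≤ []                   = []
differencesFrom-≤ {c = c} {x = x ∷ _} (x≤N ∷ xs≤N) = ≤-trans (m∸n≤m x c) x≤N ∷ differencesFrom-≤ xs≤N

strictlyIncreasing⇔Linked : {x : Vec ℕ n} → T (strictlyIncreasing x) ⇔ Linked _<_ x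
strictlyIncreasing⇔Linked = mk⇔ to from
  where
  to : ∀ {n} {x : Vec ℕ n} → T (strictlyIncreasing x) → Linked _<_ x
  to {x = []}        _ = []
  to {x = _ ∷ []}    _ = [-]
  to {x = a ∷ b ∷ x} t = <ᵇ⇒< a b (proj₁ split) ∷ to (proj₂ split)
    where
    split : T (a <ᵇ b) × T (strictlyIncreasing (b ∷ x))
    split = Equivalence.to T-∧ t

  from : ∀ {n} {x : Vec ℕ n} → Linked _<_ x → T (strictlyIncreasing x)
  from []        = _
  from [-]       = _
  from {x = _ ∷ _ ∷ _} (a<b ∷ l) = Equivalence.from T-∧ (<⇒<ᵇ a<b , from l)

sum≤dot : ∀ {u : Vec ℕ n} → VAll (0 <_) u → (v : Vec ℕ n) → sum v ≤ dot u v
sum≤dot []                      []      = z≤n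
sum≤dot {u = a ∷ _} (0<a ∷ 0<u) (b ∷ v) =
  +-mono-≤ (subst (_≤ a * b) (*-identityˡ b) (*-monoˡ-≤ b 0<a)) (sum≤dot 0<u v)

dot-comm : (u v : Vec ℕ n) → dot u v ≡ dot v u
dot-comm []      []      = refl
dot-comm (a ∷ u) (b ∷ v) = cong₂ _+_ (*-comm a b) (dot-comm u v)

dot-partialSumsFrom : ∀ c (v d : Vec ℕ n) → c * sum v + dot (tailSums v) d ≡ dot v (partialSumsFrom c d)
dot-partialSumsFrom c []      []      = trans (+-identityʳ (c * 0)) (*-zeroʳ c)
dot-partialSumsFrom c (b ∷ v) (e ∷ d) = begin
  c * (b + sum v) + ((b + sum v) * e + dot (tailSums v) d)   ≡⟨ regroup c b (sum v) e (dot (tailSums v) d) ⟩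
  b * (c + e) + ((c + e) * sum v + dot (tailSums v) d)       ≡⟨ cong (λ t → b * (c + e) + t) (dot-partialSumsFrom (c + e) v d) ⟩
  b * (c + e) + dot v (partialSumsFrom (c + e) d)            ∎
  where
  open ≡-Reasoning
  regroup : ∀ c b s e D → c * (b + s) + ((b + s) * e + D) ≡ b * (c + e) + ((c + e) * s + D)
  regroup = solve-∀

sum-∷ʳ : (xs : Vec ℕ n) (a : ℕ) → sum (xs ∷ʳ a) ≡ sum xs + a
sum-∷ʳ []       a = +-identityʳ a
sum-∷ʳ (x ∷ xs) a = trans (cong (x +_) (sum-∷ʳ xs a)) (sym (+-assoc x _ a))

sum-reverse : (xs : Vec ℕ n) → sum (reverse xs) ≡ sum xs
sum-reverse []       = refl
sum-reverse (x ∷ xs) = begin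
  sum (reverse (x ∷ xs))   ≡⟨ cong sum (reverse-∷ x xs) ⟩
  sum (reverse xs ∷ʳ x)    ≡⟨ sum-∷ʳ (reverse xs) x ⟩
  sum (reverse xs) + x     ≡⟨ cong (_+ x) (sum-reverse xs) ⟩
  sum xs + x               ≡⟨ +-comm (sum xs) x ⟩
  x + sum xs               ∎
  where open ≡-Reasoning

dot-∷ʳ : (xs ys : Vec ℕ n) (a b : ℕ) → dot (xs ∷ʳ a) (ys ∷ʳ b) ≡ dot xs ys + a * b
dot-∷ʳ []       []       a b = +-identityʳ (a * b)
dot-∷ʳ (x ∷ xs) (y ∷ ys) a b = trans (cong (x * y +_) (dot-∷ʳ xs ys a b)) (sym (+-assoc (x * y) _ _))

dot-reverse : (xs ys : Vec ℕ n) → dot (reverse xs) (reverse ys) ≡ dot xs ys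
dot-reverse []       []       = refl
dot-reverse (x ∷ xs) (y ∷ ys) = begin
  dot (reverse (x ∷ xs)) (reverse (y ∷ ys))  ≡⟨ cong₂ dot (reverse-∷ x xs) (reverse-∷ y ys) ⟩
  dot (reverse xs ∷ʳ x) (reverse ys ∷ʳ y)    ≡⟨ dot-∷ʳ (reverse xs) (reverse ys) x y ⟩
  dot (reverse xs) (reverse ys) + x * y      ≡⟨ cong (_+ x * y) (dot-reverse xs ys) ⟩
  dot xs ys + x * y                          ≡⟨ +-comm (dot xs ys) (x * y) ⟩
  x * y + dot xs ys                          ∎
  where open ≡-Reasoning

partialSumsFrom-∷ʳ : ∀ c (xs : Vec ℕ n) a → partialSumsFrom c (xs ∷ʳ a) ≡ partialSumsFrom c xs ∷ʳ (c + sum xs + a)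
partialSumsFrom-∷ʳ c []       a = cong (λ c′ → c′ + a ∷ []) (sym (+-identityʳ c))
partialSumsFrom-∷ʳ c (x ∷ xs) a =
  cong (c + x ∷_) (trans (partialSumsFrom-∷ʳ (c + x) xs a) (cong (λ t → partialSumsFrom (c + x) xs ∷ʳ (t + a)) (+-assoc c x (sum xs))))

partialSums-reverse : (v : Vec ℕ n) → partialSums (reverse v) ≡ reverse (tailSums v)
partialSums-reverse []      = refl
partialSums-reverse (b ∷ v) = begin
  partialSums (reverse (b ∷ v))                  ≡⟨ cong partialSums (reverse-∷ b v) ⟩
  partialSums (reverse v ∷ʳ b)                   ≡⟨ partialSumsFrom-∷ʳ 0 (reverse v) b ⟩
  partialSums (reverse v) ∷ʳ (sum (reverse v) + b) ≡⟨ cong₂ _∷ʳ_ (partialSums-reverse v) (trans (cong (_+ b) (sum-reverse v)) (+-comm (sum v) b)) ⟩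
  reverse (tailSums v) ∷ʳ (b + sum v)            ≡⟨ reverse-∷ (b + sum v) (tailSums v) ⟨
  reverse (tailSums (b ∷ v))                     ∎
  where open ≡-Reasoning

All-∷ʳ : ∀ {P : ℕ → Set} {xs : Vec ℕ n} {a} → VAll P xs → P a → VAll P (xs ∷ʳ a)
All-∷ʳ []         pa = pa ∷ []
All-∷ʳ (px ∷ pxs) pa = px ∷ All-∷ʳ pxs pa

All-reverse : ∀ {P : ℕ → Set} {xs : Vec ℕ n} → VAll P xs → VAll P (reverse xs)
All-reverse []                          = []
All-reverse {P = P} {x ∷ xs} (px ∷ pxs) = subst (VAll P) (sym (reverse-∷ x xs)) (All-∷ʳ (All-reverse pxs) px)

at : Vec ℕ n → ℕ → ℕ
at []       _       = 0
at (x ∷ xs) zero    = x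
at (x ∷ xs) (suc k) = at xs k

at-lookup : (xs : Vec ℕ n) (j : Fin n) → at xs (toℕ j) ≡ lookup xs j
at-lookup (x ∷ xs) zero    = refl
at-lookup (x ∷ xs) (suc j) = at-lookup xs j

at-∷ʳ-< : ∀ (xs : Vec ℕ n) a {k} → k < n → at (xs ∷ʳ a) k ≡ at xs k
at-∷ʳ-< (x ∷ xs) a {zero}  _         = refl
at-∷ʳ-< (x ∷ xs) a {suc k} (s≤s k<n) = at-∷ʳ-< xs a k<n

at-∷ʳ-length : ∀ (xs : Vec ℕ n) a → at (xs ∷ʳ a) n ≡ a
at-∷ʳ-length []       a = refl
at-∷ʳ-length (x ∷ xs) a = at-∷ʳ-length xs a

∸-suc : ∀ {m k} → k < m → m ∸ k ≡ suc (m ∸ suc k)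
∸-suc {suc m} (s≤s k≤m) = +-∸-assoc 1 k≤m

∸-suc-< : ∀ {m k} → k < m → m ∸ suc k < m
∸-suc-< {suc m} {k} _ = s≤s (m∸n≤m m k)

∸-∸-suc : ∀ {m k} → k < m → m ∸ suc (m ∸ suc k) ≡ k
∸-∸-suc {suc m} (s≤s k≤m) = m∸[m∸n]≡n k≤m

at-reverse : ∀ (xs : Vec ℕ n) {k} → k < n → at (reverse xs) k ≡ at xs (n ∸ suc k)
at-reverse {suc m} (x ∷ xs) {k} (s≤s k≤m) rewrite reverse-∷ x xs with k ≟ m
... | yes refl = trans (at-∷ʳ-length (reverse xs) x) (cong (at (x ∷ xs)) (sym (n∸n≡0 k)))
... | no k≢m = begin
  at (reverse xs ∷ʳ x) k    ≡⟨ at-∷ʳ-< (reverse xs) x k<m ⟩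
  at (reverse xs) k         ≡⟨ at-reverse xs k<m ⟩
  at xs (m ∸ suc k)         ≡⟨ cong (at (x ∷ xs)) (∸-suc k<m) ⟨
  at (x ∷ xs) (m ∸ k)       ∎
  where
  open ≡-Reasoning
  k<m : k < m
  k<m = ≤∧≢⇒< k≤m k≢m

at-partialSumsFrom : ∀ c (a : Vec ℕ n) {k} → k < n → at (partialSumsFrom c a) k ≡ at (c ∷ partialSumsFrom c a) k + at a k
at-partialSumsFrom c (a ∷ as) {zero}  _         = refl
at-partialSumsFrom c (a ∷ as) {suc k} (s≤s k<n) = at-partialSumsFrom (c + a) as k<n

weightedSum : Vec ℕ n → (ℕ → ℤ) → ℤ
weightedSum []       f = ℤ.+ 0
weightedSum (a ∷ as) f = ℤ.+ a ℤ.* f 0 ℤ.+ weightedSum as (f ∘ suc)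

weightedSum-cong : ∀ (u : Vec ℕ n) {f g : ℕ → ℤ} → (∀ i → f i ≡ g i) → weightedSum u f ≡ weightedSum u g
weightedSum-cong []       f≗g = refl
weightedSum-cong (a ∷ as) f≗g = cong₂ (λ x y → ℤ.+ a ℤ.* x ℤ.+ y) (f≗g 0) (weightedSum-cong as (f≗g ∘ suc))

weightedSum-distrib-- : ∀ (u : Vec ℕ n) (f g : ℕ → ℤ) →
                        weightedSum u (λ i → f i ℤ.- g i) ≡ weightedSum u f ℤ.- weightedSum u g
weightedSum-distrib-- []       f g = refl
weightedSum-distrib-- (a ∷ as) f g =
  trans (cong (λ t → ℤ.+ a ℤ.* (f 0 ℤ.- g 0) ℤ.+ t) (weightedSum-distrib-- as (f ∘ suc) (g ∘ suc)))
        (regroup (ℤ.+ a) (f 0) (g 0) _ _)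
  where
  regroup : ∀ x p q s t → x ℤ.* (p ℤ.- q) ℤ.+ (s ℤ.- t) ≡ (x ℤ.* p ℤ.+ s) ℤ.- (x ℤ.* q ℤ.+ t)
  regroup = ℤ.solve-∀

indicator : Bool → ℤ
indicator b = if b then ℤ.+ 1 else ℤ.+ 0

private
  sift-step : ∀ a (w : Vec ℕ n) s R →
    ℤ.+ a ℤ.* indicator (suc s ≡ᵇ R) ℤ.+ ℤ.+ at (0 ∷ w) (R ∸ suc s) ≡ ℤ.+ at (0 ∷ a ∷ w) (R ∸ s)
  sift-step a w zero          zero          = trans (ℤ.+-identityʳ _) (ℤ.*-zeroʳ (ℤ.+ a))
  sift-step a w zero          (suc zero)    = trans (ℤ.+-identityʳ _) (ℤ.*-identityʳ (ℤ.+ a))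
  sift-step a w zero          (suc (suc R)) = cong (ℤ._+ ℤ.+ at w R) (ℤ.*-zeroʳ (ℤ.+ a))
  sift-step a w (suc s)       zero          = trans (ℤ.+-identityʳ _) (ℤ.*-zeroʳ (ℤ.+ a))
  sift-step a w (suc s)       (suc R)       = sift-step a w s R

-- Looking up in 0 ∷ u makes both R ≤ s and R > s + length u give 0, so no case split is needed.
weightedSum-indicator : ∀ (u : Vec ℕ n) s R →
  weightedSum u (λ i → indicator (suc (i + s) ≡ᵇ R)) ≡ ℤ.+ at (0 ∷ u) (R ∸ s)
weightedSum-indicator []       s R with R ∸ s
... | zero  = refl
... | suc _ = refl
weightedSum-indicator (a ∷ as) s R = begin
  ℤ.+ a ℤ.* indicator (suc s ≡ᵇ R) ℤ.+ weightedSum as (λ i → indicator (suc (suc i + s) ≡ᵇ R))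
    ≡⟨ cong (λ t → ℤ.+ a ℤ.* indicator (suc s ≡ᵇ R) ℤ.+ t)
            (trans (weightedSum-cong as (λ i → cong (λ t → indicator (suc t ≡ᵇ R)) (sym (+-suc i s))))
                   (weightedSum-indicator as (suc s) R)) ⟩
  ℤ.+ a ℤ.* indicator (suc s ≡ᵇ R) ℤ.+ ℤ.+ at (0 ∷ as) (R ∸ suc s)
    ≡⟨ sift-step a as s R ⟩
  ℤ.+ at (0 ∷ a ∷ as) (R ∸ s) ∎
  where open ≡-Reasoning

diffFormsCoeff : ℕ → ℕ → ℕ → ℤ
diffFormsCoeff r i j =
  if suc (i + j) ≡ᵇ r then ℤ.+ 1
  else if suc (suc (i + j)) ≡ᵇ r then ℤ.- (ℤ.+ 1)
  else ℤ.+ 0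

diffFormsCoeff-indicators : ∀ r i j →
  diffFormsCoeff r i j ≡ indicator (suc (i + j) ≡ᵇ r) ℤ.- indicator (suc (i + suc j) ≡ᵇ r)
diffFormsCoeff-indicators r i j rewrite +-suc i j
  with suc (i + j) ≡ᵇ r in first | suc (suc (i + j)) ≡ᵇ r in second
... | true  | true  = ⊥-elim (1+n≢n (trans (≡ᵇ⇒≡ _ r (subst T (sym second) _)) (sym (≡ᵇ⇒≡ _ r (subst T (sym first) _)))))
... | true  | false = refl
... | false | true  = refl
... | false | false = refl

weightedSum-diffFormsCoeff : ∀ {r} (u : Vec ℕ r) {j} → j < r →
  weightedSum u (λ i → diffFormsCoeff r i j) ≡ ℤ.+ at u (r ∸ suc j) ℤ.- ℤ.+ at (0 ∷ u) (r ∸ suc j)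
weightedSum-diffFormsCoeff {r} u {j} j<r = begin
  weightedSum u (λ i → diffFormsCoeff r i j)
    ≡⟨ weightedSum-cong u (λ i → diffFormsCoeff-indicators r i j) ⟩
  weightedSum u (λ i → indicator (suc (i + j) ≡ᵇ r) ℤ.- indicator (suc (i + suc j) ≡ᵇ r))
    ≡⟨ weightedSum-distrib-- u _ _ ⟩
  weightedSum u (λ i → indicator (suc (i + j) ≡ᵇ r)) ℤ.- weightedSum u (λ i → indicator (suc (i + suc j) ≡ᵇ r))
    ≡⟨ cong₂ ℤ._-_ (weightedSum-indicator u j r) (weightedSum-indicator u (suc j) r) ⟩
  ℤ.+ at (0 ∷ u) (r ∸ j) ℤ.- ℤ.+ at (0 ∷ u) (r ∸ suc j)
    ≡⟨ cong (λ k → ℤ.+ at (0 ∷ u) k ℤ.- ℤ.+ at (0 ∷ u) (r ∸ suc j)) (∸-suc j<r) ⟩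
  ℤ.+ at u (r ∸ suc j) ℤ.- ℤ.+ at (0 ∷ u) (r ∸ suc j) ∎
  where open ≡-Reasoning

partialSums-step : ∀ (a : Vec ℕ n) {k} → k < n →
  ℤ.+ at (partialSums a) k ℤ.- ℤ.+ at (0 ∷ partialSums a) k ≡ ℤ.+ at a k
partialSums-step a {k} k<n = begin
  ℤ.+ at (partialSums a) k ℤ.- ℤ.+ p  ≡⟨ cong (λ t → ℤ.+ t ℤ.- ℤ.+ p) (at-partialSumsFrom 0 a k<n) ⟩
  ℤ.+ (p + x) ℤ.- ℤ.+ p               ≡⟨ ℤ.m-n≡m⊖n (p + x) p ⟩
  (p + x) ℤ.⊖ p                       ≡⟨ ℤ.⊖-≥ (m≤m+n p x) ⟩
  ℤ.+ (p + x ∸ p)                     ≡⟨ cong ℤ.+_ (m+n∸m≡n p x) ⟩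
  ℤ.+ x                               ∎
  where
  open ≡-Reasoning
  p x : ℕ
  p = at (0 ∷ partialSums a) k
  x = at a k

-- applyForms zs u is, definitionally, the coefficient vector of Σᵢ uᵢ zᵢ computed inside H.
column : ∀ {d k} → Vec (Vec ℤ k) d → Vec ℕ d → Fin k → ℤ
column zs u j = Vec.foldr _ ℤ._+_ (ℤ.+ 0) (Vec.zipWith (λ uᵢ zᵢ → (ℤ.+ uᵢ) ℤ.* lookup zᵢ j) u zs)

applyForms : ∀ {d k} → Vec (Vec ℤ k) d → Vec ℕ d → Vec ℤ k
applyForms {k = k} zs u = Vec.map (column zs u) (allFin k)

column-tabulate : ∀ {d k} (row : ℕ → Vec ℤ k) (u : Vec ℕ d) j →
  column (tabulate (row ∘ toℕ)) u j ≡ weightedSum u (λ i → lookup (row i) j)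
column-tabulate row []      j = refl
column-tabulate row (a ∷ u) j = cong (λ t → ℤ.+ a ℤ.* lookup (row 0) j ℤ.+ t) (column-tabulate (row ∘ suc) u j)

column-diffForms : ∀ {r} (u : Vec ℕ r) j → column (diffForms r) u j ≡ weightedSum u (λ i → diffFormsCoeff r i (toℕ j))
column-diffForms {r} u j = begin
  column (diffForms r) u j                ≡⟨ cong (λ zs → column zs u j) (tabulate-allFin (row ∘ toℕ)) ⟨
  column (tabulate (row ∘ toℕ)) u j       ≡⟨ column-tabulate row u j ⟩
  weightedSum u (λ i → lookup (row i) j)  ≡⟨ weightedSum-cong u entry ⟩
  weightedSum u (λ i → diffFormsCoeff r i (toℕ j)) ∎
  where
  open ≡-Reasoning
  row : ℕ → Vec ℤ r
  row i = Vec.map (diffFormsCoeff r i ∘ toℕ) (allFin r)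
  entry : ∀ i → lookup (row i) j ≡ diffFormsCoeff r i (toℕ j)
  entry i = trans (lookup-map j _ (allFin r)) (cong (diffFormsCoeff r i ∘ toℕ) (lookup-allFin j))

applyForms-diffForms : ∀ {r} (v : Vec ℕ r) → applyForms (diffForms r) (partialSums (reverse v)) ≡ Vec.map ℤ.+_ v
applyForms-diffForms {r} v = trans (map-cong column≡ (allFin r)) (map-lookup-allFin (Vec.map ℤ.+_ v))
  where
  u : Vec ℕ r
  u = partialSums (reverse v)

  column≡ : ∀ j → column (diffForms r) u j ≡ lookup (Vec.map ℤ.+_ v) j
  column≡ j = begin
    column (diffForms r) u j                         ≡⟨ column-diffForms u j ⟩
    weightedSum u (λ i → diffFormsCoeff r i (toℕ j)) ≡⟨ weightedSum-diffFormsCoeff u (toℕ<n j) ⟩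
    ℤ.+ at u k ℤ.- ℤ.+ at (0 ∷ u) k                 ≡⟨ partialSums-step (reverse v) k<r ⟩
    ℤ.+ at (reverse v) k                             ≡⟨ cong ℤ.+_ (at-reverse v k<r) ⟩
    ℤ.+ at v (r ∸ suc k)                             ≡⟨ cong (ℤ.+_ ∘ at v) (∸-∸-suc (toℕ<n j)) ⟩
    ℤ.+ at v (toℕ j)                                 ≡⟨ cong ℤ.+_ (at-lookup v j) ⟩
    ℤ.+ lookup v j                                   ≡⟨ lookup-map j ℤ.+_ v ⟨
    lookup (Vec.map ℤ.+_ v) j                        ∎
    where
    open ≡-Reasoning
    k : ℕ
    k = r ∸ suc (toℕ j)
    k<r : k < r
    k<r = ∸-suc-< (toℕ<n j)

Linked-<-All : ∀ {c} {x : Vec ℕ n} → Linked _<_ (c ∷ x) → VAll (c <_) x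
Linked-<-All [-]          = []
Linked-<-All (c<x ∷ x<xs) = Linked⇒All <-trans c<x x<xs

increasing-from-0 : ∀ {N} {u : Vec ℕ n} → InBox N u → T (strictlyIncreasing u) → Linked _<_ (0 ∷ u)
increasing-from-0 []                 _ = [-]
increasing-from-0 ((0<a , _) ∷ _) t = 0<a ∷ Equivalence.to strictlyIncreasing⇔Linked t

admissible : ℕ → Vec ℕ n × Vec ℕ n → Bool
admissible N (u , v) = strictlyIncreasing u ∧ (dot u v ≡ᵇ N)

dual : Vec ℕ n × Vec ℕ n → Vec ℕ n × Vec ℕ n
dual (u , v) = partialSums (reverse v) , reverse (differences u)

dual-involutive : ∀ {u v : Vec ℕ n} → Linked _≤_ (0 ∷ u) → dual (dual (u , v)) ≡ (u , v)
dual-involutive {u = u} {v} 0≤u = cong₂ _,_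
  (trans (cong partialSums (reverse-involutive (differences u))) (partialSumsFrom-differencesFrom 0≤u))
  (trans (cong reverse (differencesFrom-partialSumsFrom 0 (reverse v))) (reverse-involutive v))

dual-dot : ∀ {u : Vec ℕ n} (v : Vec ℕ n) → Linked _≤_ (0 ∷ u) → uncurry dot (dual (u , v)) ≡ dot u v
dual-dot {u = u} v 0≤u = begin
  dot (partialSums (reverse v)) (reverse (differences u))  ≡⟨ cong (λ w → dot w (reverse (differences u))) (partialSums-reverse v) ⟩
  dot (reverse (tailSums v)) (reverse (differences u))     ≡⟨ dot-reverse (tailSums v) (differences u) ⟩
  dot (tailSums v) (differences u)                         ≡⟨ dot-partialSumsFrom 0 v (differences u) ⟩
  dot v (partialSums (differences u))                      ≡⟨ cong (dot v) (partialSumsFrom-differencesFrom 0≤u) ⟩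
  dot v u                                                  ≡⟨ dot-comm v u ⟩
  dot u v                                                  ∎
  where open ≡-Reasoning

dual-involution-InBox : ∀ {N} {u v : Vec ℕ n} → InBox N u → InBox N v → T (admissible N (u , v)) →
  InBox N (proj₁ (dual (u , v))) × InBox N (proj₂ (dual (u , v))) ×
  T (admissible N (dual (u , v))) × dual (dual (u , v)) ≡ (u , v)
dual-involution-InBox {N = N} {u} {v} u∈box v∈box adm =
  VAll.zip (Linked-<-All increasing′ , partialSumsFrom-≤ (reverse v) sum≤N) ,
  All-reverse (VAll.zip (differencesFrom-positive increasing , differencesFrom-≤ (proj₂ (VAll.unzip u∈box)))) ,
  Equivalence.from T-∧ (Equivalence.from strictlyIncreasing⇔Linked (Linked.tail increasing′) ,
                        ≡⇒≡ᵇ _ N (trans (dual-dot v (Linked.map <⇒≤ increasing)) dot≡N)) ,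
  dual-involutive (Linked.map <⇒≤ increasing)
  where
  increasing : Linked _<_ (0 ∷ u)
  increasing = increasing-from-0 u∈box (proj₁ (Equivalence.to T-∧ adm))
  dot≡N : dot u v ≡ N
  dot≡N = ≡ᵇ⇒≡ (dot u v) N (proj₂ (Equivalence.to T-∧ adm))
  increasing′ : Linked _<_ (0 ∷ partialSums (reverse v))
  increasing′ = partialSumsFrom-increasing 0 (All-reverse (proj₁ (VAll.unzip v∈box)))
  sum≤N : sum (reverse v) ≤ N
  sum≤N = subst₂ _≤_ (sym (sum-reverse v)) dot≡N (sum≤dot (proj₁ (VAll.unzip u∈box)) v)

dual-involution : ∀ {N} {x : Vec ℕ n × Vec ℕ n} → let boxes = boxVecs n N in
  x ∈ cartesianProduct boxes boxes → T (admissible N x) →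
  dual x ∈ cartesianProduct boxes boxes × T (admissible N (dual x)) × dual (dual x) ≡ x
dual-involution {n} {N} x∈ adm
  with u∈ , v∈ ← ∈-cartesianProduct⁻ (boxVecs n N) (boxVecs n N) x∈
  with u′∈box , v′∈box , adm′ , involutive ← dual-involution-InBox (∈-boxVecs⁻ u∈) (∈-boxVecs⁻ v∈) adm
  = ∈-cartesianProduct⁺ (∈-boxVecs⁺ u′∈box) (∈-boxVecs⁺ v′∈box) , adm′ , involutive

ΣuvAt≡∑ : ∀ d N (F : Vec ℕ d → Vec ℕ d → ℚ) →
  ΣuvAt d N F ≡ ∑ (cartesianProduct (boxVecs d N) (boxVecs d N)) (restrict (admissible N) (uncurry F))
ΣuvAt≡∑ d N F = cong Σℚ (trans (sym (cartesianProductWith≡concatMap (λ u v → summand (u , v)) boxes boxes))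
                               (sym (map-cartesianProductWith summand _,_ boxes boxes)))
  where
  boxes : List (Vec ℕ d)
  boxes = boxVecs d N
  summand : Vec ℕ d × Vec ℕ d → ℚ
  summand = restrict (admissible N) (uncurry F)

binomials-of-ones : ∀ (w : Vec ℕ n) →
  Πℚ (Vec.zipWith (λ wᵢ nᵢ → ℤ.+ ((wᵢ ∸ 1) C (nᵢ ∸ 1)) ℚ./ 1) w (replicate n 1)) ≡ 1ℚ
binomials-of-ones []      = refl
binomials-of-ones (_ ∷ w) = trans (ℚ.*-identityˡ _) (binomials-of-ones w)

gSummand : Vec ℕ n → Vec ℕ n × Vec ℕ n → ℚ
gSummand m (_ , v) = Πℚ (Vec.zipWith (λ vᵢ mᵢ → powDivFact (ℤ.+ vᵢ) mᵢ) v m)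

hSummand : Vec ℕ n → Vec ℕ n × Vec ℕ n → ℚ
hSummand {n} m (u , w) =
  Πℚ (Vec.zipWith (λ wᵢ nᵢ → ℤ.+ ((wᵢ ∸ 1) C (nᵢ ∸ 1)) ℚ./ 1) w (replicate n 1))
    ℚ.* Πℚ (Vec.zipWith powDivFact (applyForms (diffForms n) u) m)

hSummand∘dual : ∀ (m : Vec ℕ n) x → hSummand m (dual x) ≡ gSummand m x
hSummand∘dual {n} m (u , v) = begin
  hSummand m (dual (u , v))
    ≡⟨ cong (ℚ._* _) (binomials-of-ones (reverse (differences u))) ⟩
  1ℚ ℚ.* Πℚ (Vec.zipWith powDivFact (applyForms (diffForms n) (partialSums (reverse v))) m)
    ≡⟨ ℚ.*-identityˡ _ ⟩
  Πℚ (Vec.zipWith powDivFact (applyForms (diffForms n) (partialSums (reverse v))) m)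
    ≡⟨ cong (λ c → Πℚ (Vec.zipWith powDivFact c m)) (applyForms-diffForms v) ⟩
  Πℚ (Vec.zipWith powDivFact (Vec.map ℤ.+_ v) m)
    ≡⟨ cong Πℚ (zipWith-map₁ powDivFact ℤ.+_ v m) ⟩
  gSummand m (u , v) ∎
  where open ≡-Reasoning

proposition4p1 : (r : ℕ) → 0 < r → (N : ℕ) (m : Vec ℕ r) →
    g r N m ≡ H r r (replicate r 1) (diffForms r) N m
proposition4p1 r _ N m = begin
  g r N m                                      ≡⟨ ΣuvAt≡∑ r N _ ⟩
  ∑ boxes² (restrict (admissible N) (gSummand m)) ≡⟨ ∑-restrict-involution (gSummand m) (hSummand m) (λ {x} _ _ → hSummand∘dual m x) ⟩
  ∑ boxes² (restrict (admissible N) (hSummand m)) ≡⟨ ΣuvAt≡∑ r N _ ⟨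
  H r r (replicate r 1) (diffForms r) N m      ∎
  where
  open ≡-Reasoning
  boxes² : List (Vec ℕ r × Vec ℕ r)
  boxes² = cartesianProduct (boxVecs r N) (boxVecs r N)
  open Reindex (×-≡-dec (Vec-≡-dec _≟_) (Vec-≡-dec _≟_))
               (Unique.cartesianProduct⁺ (boxVecs-unique r N) (boxVecs-unique r N))
               (admissible N) dual dual-involution
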